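{- In the natural deduction system for $\mathsf{Inc}$, let $\alpha$ be a first-order formula, $\phi,\psi$ $\mathsf{Inc}$-formulas, and $x\notin\mathsf{Fv}(\psi)$. Then (writing $\theta\dashv\vdash\theta'$ for $\theta\vdash\theta'$ and $\theta'\vdash\theta$): (i) $\neg\forall x\alpha\dashv\vdash\exists x\neg\alpha$ and $\neg\exists x\alpha\dashv\vdash\forall x\neg\alpha$; (ii) $\forall x\phi\wedge\psi\dashv\vdash\forall x(\phi\wedge\psi)$; (iii) $\exists x\phi\wedge\psi\dashv\vdash\exists x(\phi\wedge\psi)$; (iv) $\exists x\phi\vee\psi\dashv\vdash\exists x(\phi\vee\psi)$.
   Context: Syntax. $\mathscr{L}$ is a first-order signature with equality. First-order formulas are $\alpha::=\bot\mid t_1=t_2\mid Rt_1\dots t_n\mid\neg\alpha\mid\alpha\wedge\alpha\mid\alpha\vee\alpha\mid\exists x\alpha\mid\forall x\alpha$; $\alpha\to\beta$ abbreviates $\neg\alpha\vee\beta$, $\alpha\leftrightarrow\beta$ abbreviates $(\alpha\to\beta)\wedge(\beta\to\alpha)$. $\mathsf{Inc}$-formulas are $\phi::=\bot\mid\alpha\mid\neg\alpha\mid x_1\dots x_n\subseteq y_1\dots y_n\mid\phi\wedge\phi\mid\phi\vee\phi\mid\exists x\phi\mid\forall x\phi$ with $\alpha$ first-order. Free variables ($\mathsf{Fv}$) as usual, with $\mathsf{Fv}(x_1\dots x_n\subseteq y_1\dots y_n)=\{x_1,\dots,y_n\}$. Sans-serif letters denote finite (possibly empty) sequences of variables, $|\mathsf{x}|$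 the length, $\exists\mathsf{x}$ / $\forall\mathsf{x}$ strings of quantifiers, $\mathsf{x}=\mathsf{y}$ abbreviates $\bigwedge_i x_i=y_i$, $\phi(t/x)$ substitution ($t$ free for $x$). Deduction system. $\Gamma\vdash\phi$ means $\phi$ is derivable from $\Gamma$ with the following rules ($\phi,\psi,\chi$ arbitrary $\mathsf{Inc}$-formulas, $\alpha$ first-order; "fresh" = not occurring in the formulas involved; "invertible" rules apply in both directions): (=I) derive $t=t$. (=Sub) from $t=t'$ and $\phi(t/x)$ derive $\phi(t'/x)$. ($\neg$I) from a derivation of $\bot$ from assumption $\alpha$ derive $\neg\alpha$; ($\neg$E) from $\alpha$ and $\neg\alpha$ derive any $\phi$; (RAA) from a derivation of $\bot$ from assumption $\neg\alpha$ derive $\alpha$; in $\neg$I and RAA all other undischarged assumptions of the subderivation must be first-order. ($\wedge$I), ($\wedge$E), ($\vee$I) as usual. ($\vee$E) from $\phi\vee\psi$, a derivation of $\chi$ from $\phi$ and one of $\chi$ from $\psi$, derive $\chi$, provided all other undischarged assumptions of the subderivations are first-order. ($\exists$I) from $\phi(t/x)$ derive $\exists x\phi$. ($\exists$E) from $\exists x\phi$ and a derivation of $\psi$ from $\phi$ derive $\psi$, provided $x$ is not free in $\psi$ nor in other undischarged assumptions of that subderivation. ($\forall$I) from $\phi$ derive $\forall x\phi$ if $x$ is not free in any undischarged assumption. ($\forall$E) from $\forall x\alpha$ derive $\alpha(t/x)$. ($\forall$E$_0$) from $\forall x\phi$ derive $\phi$ if $x$ is not free in $\phi$. ($\forall$Sub)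 from $\forall x\phi$ and a derivation of $\psi$ from $\phi(y/x)$ derive $\forall y\psi$, provided $y$ is not free in $\forall x\phi$ nor in other undischarged assumptions of the subderivation. ($\forall$Exc) from $\forall x\forall y\phi$ derive $\forall y\forall x\phi$. ($\forall_\wedge$Ext) from $\forall x\phi$ and $\forall x\psi$ derive $\forall x(\phi\wedge\psi)$. ($\forall_\vee$Ext, invertible) $\forall x\phi(x,\mathsf{v})\vee\psi(\mathsf{v})$ / $\exists y\exists z\forall x((\phi\wedge y=z)\vee(\psi\wedge y\neq z))$, $x$ not free in $\psi$, $y,z$ fresh. ($\subseteq$Exc) from $\mathsf{x}\mathsf{y}\mathsf{z}\subseteq\mathsf{u}\mathsf{v}\mathsf{w}$ derive $\mathsf{y}\mathsf{x}\mathsf{z}\subseteq\mathsf{v}\mathsf{u}\mathsf{w}$. ($\subseteq$Ctr) from $\mathsf{x}\mathsf{y}\subseteq\mathsf{u}\mathsf{v}$ derive $\mathsf{x}\subseteq\mathsf{u}$ ($|\mathsf{x}|=|\mathsf{u}|$). ($\subseteq$Trs) from $\mathsf{x}\subseteq\mathsf{y}$ and $\mathsf{y}\subseteq\mathsf{z}$ derive $\mathsf{x}\subseteq\mathsf{z}$. ($\subseteq$Cmp) from $\mathsf{y}\subseteq\mathsf{x}$ and $\alpha(\mathsf{x}/\mathsf{z})$ derive $\alpha(\mathsf{y}/\mathsf{z})$, the free variables of $\alpha(\mathsf{x}/\mathsf{z})$ being among $\mathsf{x}$. ($\subseteq$Exp) from a derivation of $\bot$ from assumptions $\mathsf{y}\subseteq\mathsf{x}$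 and $\neg\alpha(\mathsf{y}/\mathsf{z})$ derive $\alpha(\mathsf{x}/\mathsf{z})$, where the free variables of $\alpha(\mathsf{y}/\mathsf{z})$ are among $\mathsf{y}$ and the variables of $\mathsf{y}$ are not free in any other undischarged assumption. ($\subseteq$W$_\exists$) from $\mathsf{x}\subseteq\mathsf{y}$ derive $\exists w(\mathsf{x}w\subseteq\mathsf{y}z)$, $w$ not among $\mathsf{x}\mathsf{y}z$. ($\subseteq$W$_\forall$) from $\mathsf{x}\subseteq\mathsf{y}$ derive $\forall w(\mathsf{x}z\subseteq\mathsf{y}w)$, $w$ not among $\mathsf{x}\mathsf{y}z$. ($\forall\subseteq$Sim, invertible) $\forall\mathsf{x}\phi(\mathsf{x},\mathsf{z})$ / $\exists\mathsf{x}\forall\mathsf{y}(\mathsf{z}\mathsf{y}\subseteq\mathsf{z}\mathsf{x}\wedge\phi(\mathsf{x},\mathsf{z}))$, $\mathsf{y}$ fresh, $|\mathsf{y}|=|\mathsf{x}|$. ($\exists\subseteq$Ext) from $\exists\mathsf{x}(\bigwedge_{i\in I}\rho^i\subseteq\sigma^i\wedge\alpha)\vee\phi$ derive $\exists\mathsf{x}\exists u\exists v(\bigwedge_{i\in I}\rho^iuv\subseteq\sigma^iuv\wedge(\alpha\leftrightarrow u=v)\wedge(\alpha\vee\phi))$, $I$ finite, $\rho^i,\sigma^i$ equal-length sequences of variables from $\mathsf{x}$, $u,v$ fresh. -}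

module Defs where

open import Data.Nat using (ℕ; _+_; _≟_)
open import Data.Product using (Σ; _×_; _,_)
open import Data.List using (List; []; _∷_; _++_; map)
open import Data.List.Membership.Propositional using (_∈_; _∉_)
open import Data.List.Relation.Unary.All using (All)
open import Data.List.Relation.Unary.Unique.Propositional using (Unique)
open import Data.Vec using (Vec; []; _∷_; toList; zipWith) renaming (_++_ to _++ᵛ_; _∷ʳ_ to _∷ʳᵛ_)
open import Data.Vec.Relation.Binary.Pointwise.Inductive using (Pointwise)
open import Relation.Binary.PropositionalEquality using (_≡_; _≢_)
open import Relation.Nullary using (¬_; yes; no)

record Signature : Set₁ where
  field
    Fun    : Set
    funAr  : Fun → ℕ
    Rel    : Set
    relAr  : Rel → ℕ
open Signature public

-- Variables are named (natural numbers), since the rules have freshness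
-- and "not free in" side conditions.
Var : Set
Var = ℕ

module _ {S : Signature} where

  data Term : Set where
    var : Var → Term
    fn  : (f : Fun S) → Vec Term (funAr S f) → Term

  -- Formulas.  One syntax for both first-order and Inc-formulas; the
  -- predicates IsFO / IsInc below carve out the two grammars.
  infix  6 _≐_ _⊆ᶠ_
  infixr 5 ¬ᶠ_
  infixr 4 _∧ᶠ_
  infixr 3 _∨ᶠ_

  data Fm : Set where
    ⊥ᶠ    : Fm
    _≐_   : Term → Term → Fm
    rel   : (R : Rel S) → Vec Term (relAr S R) → Fm
    ¬ᶠ_   : Fm → Fm
    _⊆ᶠ_  : {n : ℕ} → Vec Var n → Vec Var n → Fm
    _∧ᶠ_  : Fm → Fm → Fm
    _∨ᶠ_  : Fm → Fm → Fm
    ∃ᶠ    : Var → Fm → Fm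
    ∀ᶠ    : Var → Fm → Fm

  data IsFO : Fm → Set where
    fo-⊥   : IsFO ⊥ᶠ
    fo-≐   : ∀ {t u} → IsFO (t ≐ u)
    fo-rel : ∀ {R ts} → IsFO (rel R ts)
    fo-¬   : ∀ {α} → IsFO α → IsFO (¬ᶠ α)
    fo-∧   : ∀ {α β} → IsFO α → IsFO β → IsFO (α ∧ᶠ β)
    fo-∨   : ∀ {α β} → IsFO α → IsFO β → IsFO (α ∨ᶠ β)
    fo-∃   : ∀ {x α} → IsFO α → IsFO (∃ᶠ x α)
    fo-∀   : ∀ {x α} → IsFO α → IsFO (∀ᶠ x α)

  data IsInc : Fm → Set where
    inc-fo : ∀ {α} → IsFO α → IsInc α
    inc-¬  : ∀ {α} → IsFO α → IsInc (¬ᶠ α)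
    inc-⊆  : ∀ {n} {xs ys : Vec Var n} → IsInc (xs ⊆ᶠ ys)
    inc-∧  : ∀ {φ ψ} → IsInc φ → IsInc ψ → IsInc (φ ∧ᶠ ψ)
    inc-∨  : ∀ {φ ψ} → IsInc φ → IsInc ψ → IsInc (φ ∨ᶠ ψ)
    inc-∃  : ∀ {x φ} → IsInc φ → IsInc (∃ᶠ x φ)
    inc-∀  : ∀ {x φ} → IsInc φ → IsInc (∀ᶠ x φ)

  _→ᶠ_ : Fm → Fm → Fm
  α →ᶠ β = ¬ᶠ α ∨ᶠ β

  _↔ᶠ_ : Fm → Fm → Fm
  α ↔ᶠ β = (α →ᶠ β) ∧ᶠ (β →ᶠ α)

  ∃* : List Var → Fm → Fm
  ∃* [] φ = φ
  ∃* (x ∷ xs) φ = ∃ᶠ x (∃* xs φ)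

  ∀* : List Var → Fm → Fm
  ∀* [] φ = φ
  ∀* (x ∷ xs) φ = ∀ᶠ x (∀* xs φ)

  ⋀∧ : List Fm → Fm → Fm
  ⋀∧ [] β = β
  ⋀∧ (χ ∷ χs) β = χ ∧ᶠ ⋀∧ χs β

  mutual
    data OccT (v : Var) : Term → Set where
      occ-var : OccT v (var v)
      occ-fn  : ∀ {f ts} → OccTs v ts → OccT v (fn f ts)

    data OccTs (v : Var) : ∀ {n} → Vec Term n → Set where
      occ-hd : ∀ {n t} {ts : Vec Term n} → OccT v t → OccTs v (t ∷ ts)
      occ-tl : ∀ {n t} {ts : Vec Term n} → OccTs v ts → OccTs v (t ∷ ts)

  data Free (v : Var) : Fm → Set where
    fr-≐₁  : ∀ {t u} → OccT v t → Free v (t ≐ u)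
    fr-≐₂  : ∀ {t u} → OccT v u → Free v (t ≐ u)
    fr-rel : ∀ {R ts} → OccTs v ts → Free v (rel R ts)
    fr-¬   : ∀ {α} → Free v α → Free v (¬ᶠ α)
    fr-⊆₁  : ∀ {n} {xs ys : Vec Var n} → v ∈ toList xs → Free v (xs ⊆ᶠ ys)
    fr-⊆₂  : ∀ {n} {xs ys : Vec Var n} → v ∈ toList ys → Free v (xs ⊆ᶠ ys)
    fr-∧₁  : ∀ {φ ψ} → Free v φ → Free v (φ ∧ᶠ ψ)
    fr-∧₂  : ∀ {φ ψ} → Free v ψ → Free v (φ ∧ᶠ ψ)
    fr-∨₁  : ∀ {φ ψ} → Free v φ → Free v (φ ∨ᶠ ψ)
    fr-∨₂  : ∀ {φ ψ} → Free v ψ → Free v (φ ∨ᶠ ψ)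
    fr-∃   : ∀ {x φ} → v ≢ x → Free v φ → Free v (∃ᶠ x φ)
    fr-∀   : ∀ {x φ} → v ≢ x → Free v φ → Free v (∀ᶠ x φ)

  data Occurs (v : Var) : Fm → Set where
    oc-≐₁  : ∀ {t u} → OccT v t → Occurs v (t ≐ u)
    oc-≐₂  : ∀ {t u} → OccT v u → Occurs v (t ≐ u)
    oc-rel : ∀ {R ts} → OccTs v ts → Occurs v (rel R ts)
    oc-¬   : ∀ {α} → Occurs v α → Occurs v (¬ᶠ α)
    oc-⊆₁  : ∀ {n} {xs ys : Vec Var n} → v ∈ toList xs → Occurs v (xs ⊆ᶠ ys)
    oc-⊆₂  : ∀ {n} {xs ys : Vec Var n} → v ∈ toList ys → Occurs v (xs ⊆ᶠ ys)
    oc-∧₁  : ∀ {φ ψ} → Occurs v φ → Occurs v (φ ∧ᶠ ψ)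
    oc-∧₂  : ∀ {φ ψ} → Occurs v ψ → Occurs v (φ ∧ᶠ ψ)
    oc-∨₁  : ∀ {φ ψ} → Occurs v φ → Occurs v (φ ∨ᶠ ψ)
    oc-∨₂  : ∀ {φ ψ} → Occurs v ψ → Occurs v (φ ∨ᶠ ψ)
    oc-∃x  : ∀ {φ} → Occurs v (∃ᶠ v φ)
    oc-∃   : ∀ {x φ} → Occurs v φ → Occurs v (∃ᶠ x φ)
    oc-∀x  : ∀ {φ} → Occurs v (∀ᶠ v φ)
    oc-∀   : ∀ {x φ} → Occurs v φ → Occurs v (∀ᶠ x φ)

  Fresh : Var → List Fm → Set
  Fresh v θs = All (λ θ → ¬ Occurs v θ) θs

  Sb : Set
  Sb = List (Var × Term)

  lookupSb : Sb → Var → Term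
  lookupSb [] v = var v
  lookupSb ((k , t) ∷ σ) v with k ≟ v
  ... | yes _ = t
  ... | no  _ = lookupSb σ v

  removeSb : Var → Sb → Sb
  removeSb y [] = []
  removeSb y ((k , t) ∷ σ) with k ≟ y
  ... | yes _ = removeSb y σ
  ... | no  _ = (k , t) ∷ removeSb y σ

  mutual
    substT : Sb → Term → Term
    substT σ (var v) = lookupSb σ v
    substT σ (fn f ts) = fn f (substTs σ ts)

    substTs : Sb → ∀ {n} → Vec Term n → Vec Term n
    substTs σ [] = []
    substTs σ (t ∷ ts) = substT σ t ∷ substTs σ ts

  NoCapture : Sb → Var → Fm → Set
  NoCapture σ y φ = ∀ k → k ≢ y → Free k φ → ¬ OccT y (lookupSb σ k)

  -- Inside an inclusion atom, variables may only be replaced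
  -- by variables (inclusion atoms contain variables only); otherwise the
  -- substitution is undefined.
  data Subst (σ : Sb) : Fm → Fm → Set where
    s-⊥   : Subst σ ⊥ᶠ ⊥ᶠ
    s-≐   : ∀ {t u} → Subst σ (t ≐ u) (substT σ t ≐ substT σ u)
    s-rel : ∀ {R ts} → Subst σ (rel R ts) (rel R (substTs σ ts))
    s-¬   : ∀ {α α'} → Subst σ α α' → Subst σ (¬ᶠ α) (¬ᶠ α')
    s-⊆   : ∀ {n} {xs ys xs' ys' : Vec Var n}
            → Pointwise (λ a b → lookupSb σ a ≡ var b) xs xs'
            → Pointwise (λ a b → lookupSb σ a ≡ var b) ys ys'
            → Subst σ (xs ⊆ᶠ ys) (xs' ⊆ᶠ ys')
    s-∧   : ∀ {φ ψ φ' ψ'} → Subst σ φ φ' → Subst σ ψ ψ' → Subst σ (φ ∧ᶠ ψ) (φ' ∧ᶠ ψ')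
    s-∨   : ∀ {φ ψ φ' ψ'} → Subst σ φ φ' → Subst σ ψ ψ' → Subst σ (φ ∨ᶠ ψ) (φ' ∨ᶠ ψ')
    s-∃   : ∀ {y φ φ'} → NoCapture σ y φ → Subst (removeSb y σ) φ φ'
            → Subst σ (∃ᶠ y φ) (∃ᶠ y φ')
    s-∀   : ∀ {y φ φ'} → NoCapture σ y φ → Subst (removeSb y σ) φ φ'
            → Subst σ (∀ᶠ y φ) (∀ᶠ y φ')

  _[_/_]≔_ : Fm → Term → Var → Fm → Set
  φ [ t / x ]≔ φ' = Subst ((x , t) ∷ []) φ φ'

  _[_/*_]≔_ : ∀ {n} → Fm → Vec Var n → Vec Var n → Fm → Set
  α [ xs /* zs ]≔ α' = Subst (toList (zipWith (λ z x → z , var x) zs xs)) α α'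

  FvAmong : Fm → List Var → Set
  FvAmong φ vs = ∀ v → Free v φ → v ∈ vs

  NotFreeIn : Var → Fm → Set
  NotFreeIn v φ = ¬ Free v φ

  record SimCond {n m} (φ : Fm) (xs ys : Vec Var n) (zs : Vec Var m) : Set where
    field
      fv     : FvAmong φ (toList xs ++ toList zs)
      xsUniq : Unique (toList xs)
      xzDisj : All (λ a → a ∉ toList zs) (toList xs)
      ysUniq : Unique (toList ys)
      ysFrsh : All (λ b → ¬ Occurs b φ × b ∉ toList xs × b ∉ toList zs) (toList ys)

  InclPair : Set
  InclPair = Σ ℕ (λ k → Vec Var k × Vec Var k)

  inclOf : InclPair → Fm
  inclOf (_ , ρ , σ) = ρ ⊆ᶠ σ

  inclUV : Var → Var → InclPair → Fm
  inclUV u v (_ , ρ , σ) = (ρ ++ᵛ (u ∷ v ∷ [])) ⊆ᶠ (σ ++ᵛ (u ∷ v ∷ []))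

  PairFrom : List Var → InclPair → Set
  PairFrom xs (_ , ρ , σ) = All (_∈ xs) (toList ρ) × All (_∈ xs) (toList σ)

  ExtPremise : List Var → List InclPair → Fm → Fm → Fm
  ExtPremise xs I α φ = ∃* xs (⋀∧ (map inclOf I) α) ∨ᶠ φ

  -- Side conditions on "the other undischarged
  -- assumptions of a subderivation" are imposed on the context Δ of that
  -- subderivation; weakening makes this the natural-deduction reading.

  Ctx : Set
  Ctx = List Fm

  infix 2 _⊢_

  data _⊢_ : Ctx → Fm → Set where
    hyp    : ∀ {Γ φ} → φ ∈ Γ → Γ ⊢ φ
    weaken : ∀ {Γ Δ φ} → (∀ {χ} → χ ∈ Δ → χ ∈ Γ) → Δ ⊢ φ → Γ ⊢ φ
    =I     : ∀ {Γ t} → Γ ⊢ t ≐ t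
    =Sub   : ∀ {Γ t t' x φ A B} → φ [ t / x ]≔ A → φ [ t' / x ]≔ B
             → Γ ⊢ t ≐ t' → Γ ⊢ A → Γ ⊢ B
    ¬I     : ∀ {Δ α} → IsFO α → All IsFO Δ → (α ∷ Δ) ⊢ ⊥ᶠ → Δ ⊢ ¬ᶠ α
    ¬E     : ∀ {Γ α φ} → IsFO α → IsInc φ → Γ ⊢ α → Γ ⊢ ¬ᶠ α → Γ ⊢ φ
    RAA    : ∀ {Δ α} → IsFO α → All IsFO Δ → ((¬ᶠ α) ∷ Δ) ⊢ ⊥ᶠ → Δ ⊢ α
    ∧I     : ∀ {Γ φ ψ} → Γ ⊢ φ → Γ ⊢ ψ → Γ ⊢ φ ∧ᶠ ψ
    ∧E₁    : ∀ {Γ φ ψ} → Γ ⊢ φ ∧ᶠ ψ → Γ ⊢ φ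
    ∧E₂    : ∀ {Γ φ ψ} → Γ ⊢ φ ∧ᶠ ψ → Γ ⊢ ψ
    ∨I₁    : ∀ {Γ φ ψ} → IsInc ψ → Γ ⊢ φ → Γ ⊢ φ ∨ᶠ ψ
    ∨I₂    : ∀ {Γ φ ψ} → IsInc φ → Γ ⊢ ψ → Γ ⊢ φ ∨ᶠ ψ
    ∨E     : ∀ {Γ Δ φ ψ χ} → Γ ⊢ φ ∨ᶠ ψ → All IsFO Δ
             → (φ ∷ Δ) ⊢ χ → (ψ ∷ Δ) ⊢ χ → (Γ ++ Δ) ⊢ χ
    ∃I     : ∀ {Γ x t φ A} → φ [ t / x ]≔ A → Γ ⊢ A → Γ ⊢ ∃ᶠ x φ
    ∃E     : ∀ {Γ Δ x φ ψ} → Γ ⊢ ∃ᶠ x φ → NotFreeIn x ψ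
             → All (NotFreeIn x) Δ → (φ ∷ Δ) ⊢ ψ → (Γ ++ Δ) ⊢ ψ
    ∀I     : ∀ {Γ x φ} → All (NotFreeIn x) Γ → Γ ⊢ φ → Γ ⊢ ∀ᶠ x φ
    ∀E     : ∀ {Γ x t α A} → IsFO α → α [ t / x ]≔ A → Γ ⊢ ∀ᶠ x α → Γ ⊢ A
    ∀E₀    : ∀ {Γ x φ} → NotFreeIn x φ → Γ ⊢ ∀ᶠ x φ → Γ ⊢ φ
    ∀Sub   : ∀ {Γ Δ x y φ A ψ} → Γ ⊢ ∀ᶠ x φ → φ [ var y / x ]≔ A
             → NotFreeIn y (∀ᶠ x φ) → All (NotFreeIn y) Δ
             → (A ∷ Δ) ⊢ ψ → (Γ ++ Δ) ⊢ ∀ᶠ y ψ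
    ∀Exc   : ∀ {Γ x y φ} → Γ ⊢ ∀ᶠ x (∀ᶠ y φ) → Γ ⊢ ∀ᶠ y (∀ᶠ x φ)
    ∀∧Ext  : ∀ {Γ x φ ψ} → Γ ⊢ ∀ᶠ x φ → Γ ⊢ ∀ᶠ x ψ → Γ ⊢ ∀ᶠ x (φ ∧ᶠ ψ)
    ∀∨Ext  : ∀ {Γ x y z φ ψ} → NotFreeIn x ψ
             → Fresh y (∀ᶠ x φ ∷ ψ ∷ []) → Fresh z (∀ᶠ x φ ∷ ψ ∷ []) → y ≢ z
             → Γ ⊢ ∀ᶠ x φ ∨ᶠ ψ
             → Γ ⊢ ∃ᶠ y (∃ᶠ z (∀ᶠ x ((φ ∧ᶠ var y ≐ var z) ∨ᶠ (ψ ∧ᶠ ¬ᶠ (var y ≐ var z)))))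
    ∀∨Ext⁻ : ∀ {Γ x y z φ ψ} → NotFreeIn x ψ
             → Fresh y (∀ᶠ x φ ∷ ψ ∷ []) → Fresh z (∀ᶠ x φ ∷ ψ ∷ []) → y ≢ z
             → Γ ⊢ ∃ᶠ y (∃ᶠ z (∀ᶠ x ((φ ∧ᶠ var y ≐ var z) ∨ᶠ (ψ ∧ᶠ ¬ᶠ (var y ≐ var z)))))
             → Γ ⊢ ∀ᶠ x φ ∨ᶠ ψ
    ⊆Exc   : ∀ {Γ n m k} {xs us : Vec Var n} {ys vs : Vec Var m} {zs ws : Vec Var k}
             → Γ ⊢ (xs ++ᵛ ys ++ᵛ zs) ⊆ᶠ (us ++ᵛ vs ++ᵛ ws)
             → Γ ⊢ (ys ++ᵛ xs ++ᵛ zs) ⊆ᶠ (vs ++ᵛ us ++ᵛ ws)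
    ⊆Ctr   : ∀ {Γ n m} {xs us : Vec Var n} {ys vs : Vec Var m}
             → Γ ⊢ (xs ++ᵛ ys) ⊆ᶠ (us ++ᵛ vs) → Γ ⊢ xs ⊆ᶠ us
    ⊆Trs   : ∀ {Γ n} {xs ys zs : Vec Var n}
             → Γ ⊢ xs ⊆ᶠ ys → Γ ⊢ ys ⊆ᶠ zs → Γ ⊢ xs ⊆ᶠ zs
    ⊆Cmp   : ∀ {Γ n α A B} {xs ys zs : Vec Var n} → IsFO α
             → α [ xs /* zs ]≔ A → α [ ys /* zs ]≔ B → FvAmong A (toList xs)
             → Γ ⊢ ys ⊆ᶠ xs → Γ ⊢ A → Γ ⊢ B
    ⊆Exp   : ∀ {Δ n α A B} {xs ys zs : Vec Var n} → IsFO α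
             → α [ xs /* zs ]≔ A → α [ ys /* zs ]≔ B → FvAmong B (toList ys)
             → All (λ χ → ∀ v → v ∈ toList ys → NotFreeIn v χ) Δ
             → ((ys ⊆ᶠ xs) ∷ (¬ᶠ B) ∷ Δ) ⊢ ⊥ᶠ → Δ ⊢ A
    ⊆W∃    : ∀ {Γ n w z} {xs ys : Vec Var n}
             → w ∉ toList xs → w ∉ toList ys → w ≢ z
             → Γ ⊢ xs ⊆ᶠ ys → Γ ⊢ ∃ᶠ w ((xs ∷ʳᵛ w) ⊆ᶠ (ys ∷ʳᵛ z))
    ⊆W∀    : ∀ {Γ n w z} {xs ys : Vec Var n}
             → w ∉ toList xs → w ∉ toList ys → w ≢ z
             → Γ ⊢ xs ⊆ᶠ ys → Γ ⊢ ∀ᶠ w ((xs ∷ʳᵛ z) ⊆ᶠ (ys ∷ʳᵛ w))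
    ∀⊆Sim  : ∀ {Γ n m φ} {xs ys : Vec Var n} {zs : Vec Var m}
             → SimCond φ xs ys zs
             → Γ ⊢ ∀* (toList xs) φ
             → Γ ⊢ ∃* (toList xs) (∀* (toList ys) (((zs ++ᵛ ys) ⊆ᶠ (zs ++ᵛ xs)) ∧ᶠ φ))
    ∀⊆Sim⁻ : ∀ {Γ n m φ} {xs ys : Vec Var n} {zs : Vec Var m}
             → SimCond φ xs ys zs
             → Γ ⊢ ∃* (toList xs) (∀* (toList ys) (((zs ++ᵛ ys) ⊆ᶠ (zs ++ᵛ xs)) ∧ᶠ φ))
             → Γ ⊢ ∀* (toList xs) φ
    ∃⊆Ext  : ∀ {Γ α φ u v} {xs : List Var} {I : List InclPair}
             → IsFO α → All (PairFrom xs) I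
             → Fresh u (ExtPremise xs I α φ ∷ []) → Fresh v (ExtPremise xs I α φ ∷ []) → u ≢ v
             → Γ ⊢ ExtPremise xs I α φ
             → Γ ⊢ ∃* xs (∃ᶠ u (∃ᶠ v
                      (⋀∧ (map (inclUV u v) I) ((α ↔ᶠ (var u ≐ var v)) ∧ᶠ (α ∨ᶠ φ)))))

  infix 1 _⊣⊢_
  _⊣⊢_ : Fm → Fm → Set
  θ ⊣⊢ θ' = ((θ ∷ []) ⊢ θ') × ((θ' ∷ []) ⊢ θ)

{-# OPTIONS --safe #-}
module Submission where

-- Each equivalence is the usual prenex law, obtained by instantiating ∃I, ∀E and
-- ∀Sub at the bound variable itself (the identity substitution φ(x/x) = φ) and
-- discharging the eigenvariable conditions with x ∉ Fv(ψ).  Part (i) goes through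
-- because α is first-order: ¬I and RAA may then be applied in contexts consisting
-- of first-order formulas only.

open import Defs
open import Data.Product using (_×_; _,_)
open import Data.List using ([]; _∷_)
open import Data.List.Relation.Unary.Any using (here; there)
open import Data.List.Relation.Unary.All using () renaming ([] to []ᵃ; _∷_ to _∷ᵃ_)
open import Data.Vec using (Vec) renaming ([] to []ᵛ; _∷_ to _∷ᵛ_)
open import Data.Vec.Relation.Binary.Pointwise.Inductive using (Pointwise)
  renaming ([] to []ᵖ; _∷_ to _∷ᵖ_)
open import Data.Nat using (_≟_)
open import Relation.Binary.PropositionalEquality using (_≡_; refl; cong; cong₂; subst; subst₂)
open import Relation.Nullary using (yes; no)

module _ {S : Signature} where

  data IdSb : Sb {S} → Set where
    []  : IdSb []
    _∷_ : ∀ {σ} k → IdSb σ → IdSb ((k , var k) ∷ σ)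

  lookupSb-id : ∀ {σ} → IdSb σ → ∀ v → lookupSb σ v ≡ var v
  lookupSb-id [] v = refl
  lookupSb-id (k ∷ p) v with k ≟ v
  ... | yes k≡v = cong var k≡v
  ... | no _    = lookupSb-id p v

  removeSb-id : ∀ {σ} → IdSb σ → ∀ y → IdSb (removeSb y σ)
  removeSb-id [] y = []
  removeSb-id (k ∷ p) y with k ≟ y
  ... | yes _ = removeSb-id p y
  ... | no _  = k ∷ removeSb-id p y

  mutual
    substT-id : ∀ {σ} → IdSb σ → (t : Term {S}) → substT σ t ≡ t
    substT-id p (var v)   = lookupSb-id p v
    substT-id p (fn f ts) = cong (fn f) (substTs-id p ts)

    substTs-id : ∀ {σ} → IdSb σ → ∀ {n} (ts : Vec (Term {S}) n) → substTs σ ts ≡ ts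
    substTs-id p []ᵛ       = refl
    substTs-id p (t ∷ᵛ ts) = cong₂ _∷ᵛ_ (substT-id p t) (substTs-id p ts)

  lookupSb-id-pointwise : ∀ {σ} → IdSb σ → ∀ {n} (xs : Vec Var n) →
                          Pointwise (λ a b → lookupSb σ a ≡ var b) xs xs
  lookupSb-id-pointwise p []ᵛ       = []ᵖ
  lookupSb-id-pointwise p (x ∷ᵛ xs) = lookupSb-id p x ∷ᵖ lookupSb-id-pointwise p xs

  NoCapture-id : ∀ {σ} → IdSb σ → ∀ y (φ : Fm {S}) → NoCapture σ y φ
  NoCapture-id p y φ k k≢y _ rewrite lookupSb-id p k = λ { occ-var → k≢y refl }

  Subst-id : ∀ {σ} → IdSb σ → (φ : Fm {S}) → Subst σ φ φ
  Subst-id p ⊥ᶠ = s-⊥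
  Subst-id {σ} p (t ≐ u) =
    subst₂ (λ t′ u′ → Subst σ (t ≐ u) (t′ ≐ u′)) (substT-id p t) (substT-id p u) s-≐
  Subst-id {σ} p (rel R ts) =
    subst (λ ts′ → Subst σ (rel R ts) (rel R ts′)) (substTs-id p ts) s-rel
  Subst-id p (¬ᶠ φ)     = s-¬ (Subst-id p φ)
  Subst-id p (xs ⊆ᶠ ys) = s-⊆ (lookupSb-id-pointwise p xs) (lookupSb-id-pointwise p ys)
  Subst-id p (φ ∧ᶠ ψ)   = s-∧ (Subst-id p φ) (Subst-id p ψ)
  Subst-id p (φ ∨ᶠ ψ)   = s-∨ (Subst-id p φ) (Subst-id p ψ)
  Subst-id p (∃ᶠ y φ)   = s-∃ (NoCapture-id p y φ) (Subst-id (removeSb-id p y) φ)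
  Subst-id p (∀ᶠ y φ)   = s-∀ (NoCapture-id p y φ) (Subst-id (removeSb-id p y) φ)

  subst-self : ∀ (φ : Fm {S}) x → φ [ var x / x ]≔ φ
  subst-self φ x = Subst-id (x ∷ []) φ

  notFree-∀ : ∀ x (φ : Fm {S}) → NotFreeIn x (∀ᶠ x φ)
  notFree-∀ x φ (fr-∀ x≢x _) = x≢x refl

  notFree-∃ : ∀ x (φ : Fm {S}) → NotFreeIn x (∃ᶠ x φ)
  notFree-∃ x φ (fr-∃ x≢x _) = x≢x refl

  notFree-¬ : ∀ {x} {φ : Fm {S}} → NotFreeIn x φ → NotFreeIn x (¬ᶠ φ)
  notFree-¬ nφ (fr-¬ f) = nφ f

  notFree-∧ : ∀ {x} {φ ψ : Fm {S}} → NotFreeIn x φ → NotFreeIn x ψ → NotFreeIn x (φ ∧ᶠ ψ)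
  notFree-∧ nφ nψ (fr-∧₁ f) = nφ f
  notFree-∧ nφ nψ (fr-∧₂ f) = nψ f

  notFree-∨ : ∀ {x} {φ ψ : Fm {S}} → NotFreeIn x φ → NotFreeIn x ψ → NotFreeIn x (φ ∨ᶠ ψ)
  notFree-∨ nφ nψ (fr-∨₁ f) = nφ f
  notFree-∨ nφ nψ (fr-∨₂ f) = nψ f

  hyp₀ : ∀ {Γ} {a : Fm {S}} → (a ∷ Γ) ⊢ a
  hyp₀ = hyp (here refl)

  hyp₁ : ∀ {Γ} {a b : Fm {S}} → (a ∷ b ∷ Γ) ⊢ b
  hyp₁ = hyp (there (here refl))

  contract : ∀ {Γ} {a φ : Fm {S}} → (a ∷ a ∷ Γ) ⊢ φ → (a ∷ Γ) ⊢ φ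
  contract = weaken λ where
    (here a≡)          → here a≡
    (there (here a≡))  → here a≡
    (there (there χ∈)) → there χ∈

  exchange : ∀ {Γ} {a b φ : Fm {S}} → (a ∷ b ∷ Γ) ⊢ φ → (b ∷ a ∷ Γ) ⊢ φ
  exchange = weaken λ where
    (here a≡)          → there (here a≡)
    (there (here b≡))  → here b≡
    (there (there χ∈)) → there (there χ∈)

  ∃I-self : ∀ {Γ x} {φ : Fm {S}} → Γ ⊢ φ → Γ ⊢ ∃ᶠ x φ
  ∃I-self = ∃I (subst-self _ _)

  ∀E-self : ∀ {Γ x} {α : Fm {S}} → IsFO α → Γ ⊢ ∀ᶠ x α → Γ ⊢ α
  ∀E-self fα = ∀E fα (subst-self _ _)

  ⊥-inc : IsInc (⊥ᶠ {S})
  ⊥-inc = inc-fo fo-⊥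

  ¬∀⊣⊢∃¬ : ∀ (α : Fm {S}) x → IsFO α → ¬ᶠ ∀ᶠ x α ⊣⊢ ∃ᶠ x (¬ᶠ α)
  ¬∀⊣⊢∃¬ α x fα = to , from
    where
    to : ((¬ᶠ ∀ᶠ x α) ∷ []) ⊢ ∃ᶠ x (¬ᶠ α)
    to = RAA (fo-∃ (fo-¬ fα)) (fo-¬ (fo-∀ fα) ∷ᵃ []ᵃ)
           (¬E (fo-∀ fα) ⊥-inc
             (∀I (notFree-¬ (notFree-∃ x (¬ᶠ α)) ∷ᵃ notFree-¬ (notFree-∀ x α) ∷ᵃ []ᵃ)
               (RAA fα (fo-¬ (fo-∃ (fo-¬ fα)) ∷ᵃ fo-¬ (fo-∀ fα) ∷ᵃ []ᵃ)
                 (¬E (fo-∃ (fo-¬ fα)) ⊥-inc (∃I-self hyp₀) hyp₁)))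
             hyp₁)
    from : (∃ᶠ x (¬ᶠ α) ∷ []) ⊢ ¬ᶠ ∀ᶠ x α
    from = ¬I (fo-∀ fα) (fo-∃ (fo-¬ fα) ∷ᵃ []ᵃ)
             (exchange (∃E {Γ = ∃ᶠ x (¬ᶠ α) ∷ []} hyp₀ (λ ()) (notFree-∀ x α ∷ᵃ []ᵃ)
               (¬E fα ⊥-inc (∀E-self fα hyp₁) hyp₀)))

  ¬∃⊣⊢∀¬ : ∀ (α : Fm {S}) x → IsFO α → ¬ᶠ ∃ᶠ x α ⊣⊢ ∀ᶠ x (¬ᶠ α)
  ¬∃⊣⊢∀¬ α x fα = to , from
    where
    to : ((¬ᶠ ∃ᶠ x α) ∷ []) ⊢ ∀ᶠ x (¬ᶠ α)
    to = ∀I (notFree-¬ (notFree-∃ x α) ∷ᵃ []ᵃ)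
           (¬I fα (fo-¬ (fo-∃ fα) ∷ᵃ []ᵃ) (¬E (fo-∃ fα) ⊥-inc (∃I-self hyp₀) hyp₁))
    from : (∀ᶠ x (¬ᶠ α) ∷ []) ⊢ ¬ᶠ ∃ᶠ x α
    from = ¬I (fo-∃ fα) (fo-∀ (fo-¬ fα) ∷ᵃ []ᵃ)
             (∃E {Γ = ∃ᶠ x α ∷ []} hyp₀ (λ ()) (notFree-∀ x (¬ᶠ α) ∷ᵃ []ᵃ)
               (¬E fα ⊥-inc hyp₀ (∀E-self (fo-¬ fα) hyp₁)))

  module _ {φ ψ : Fm {S}} {x : Var} (nψ : NotFreeIn x ψ) where

    ∀∧⊣⊢∀[∧] : (∀ᶠ x φ ∧ᶠ ψ) ⊣⊢ ∀ᶠ x (φ ∧ᶠ ψ)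
    ∀∧⊣⊢∀[∧] = to , from
      where
      to : ((∀ᶠ x φ ∧ᶠ ψ) ∷ []) ⊢ ∀ᶠ x (φ ∧ᶠ ψ)
      to = contract (∀Sub {Γ = (∀ᶠ x φ ∧ᶠ ψ) ∷ []} (∧E₁ hyp₀) (subst-self φ x) (notFree-∀ x φ)
                      (notFree-∧ (notFree-∀ x φ) nψ ∷ᵃ []ᵃ) (∧I hyp₀ (∧E₂ hyp₁)))
      from : (∀ᶠ x (φ ∧ᶠ ψ) ∷ []) ⊢ ∀ᶠ x φ ∧ᶠ ψ
      from = ∧I (∀Sub hyp₀ (subst-self _ x) (notFree-∀ x _) []ᵃ (∧E₁ hyp₀))
                (∀E₀ nψ (∀Sub hyp₀ (subst-self _ x) (notFree-∀ x _) []ᵃ (∧E₂ hyp₀)))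

    ∃∧⊣⊢∃[∧] : (∃ᶠ x φ ∧ᶠ ψ) ⊣⊢ ∃ᶠ x (φ ∧ᶠ ψ)
    ∃∧⊣⊢∃[∧] = to , from
      where
      to : ((∃ᶠ x φ ∧ᶠ ψ) ∷ []) ⊢ ∃ᶠ x (φ ∧ᶠ ψ)
      to = contract (∃E {Γ = (∃ᶠ x φ ∧ᶠ ψ) ∷ []} (∧E₁ hyp₀) (notFree-∃ x _)
                      (notFree-∧ (notFree-∃ x φ) nψ ∷ᵃ []ᵃ) (∃I-self (∧I hyp₀ (∧E₂ hyp₁))))
      from : (∃ᶠ x (φ ∧ᶠ ψ) ∷ []) ⊢ ∃ᶠ x φ ∧ᶠ ψ
      from = ∧I (∃E hyp₀ (notFree-∃ x φ) []ᵃ (∃I-self (∧E₁ hyp₀)))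
                (∃E hyp₀ nψ []ᵃ (∧E₂ hyp₀))

    ∃∨⊣⊢∃[∨] : IsInc φ → IsInc ψ → (∃ᶠ x φ ∨ᶠ ψ) ⊣⊢ ∃ᶠ x (φ ∨ᶠ ψ)
    ∃∨⊣⊢∃[∨] iφ iψ = to , from
      where
      to : ((∃ᶠ x φ ∨ᶠ ψ) ∷ []) ⊢ ∃ᶠ x (φ ∨ᶠ ψ)
      to = ∨E hyp₀ []ᵃ (∃E hyp₀ (notFree-∃ x _) []ᵃ (∃I-self (∨I₁ iψ hyp₀)))
                       (∃I-self (∨I₂ iφ hyp₀))
      from : (∃ᶠ x (φ ∨ᶠ ψ) ∷ []) ⊢ ∃ᶠ x φ ∨ᶠ ψ
      from = ∃E hyp₀ (notFree-∨ (notFree-∃ x φ) nψ) []ᵃ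
               (∨E hyp₀ []ᵃ (∨I₁ iψ (∃I-self hyp₀)) (∨I₂ (inc-∃ iφ) hyp₀))

mainTheorem9 :
      ( (S : Signature) (α : Fm {S}) (x : Var) → IsFO α →
          (¬ᶠ ∀ᶠ x α ⊣⊢ ∃ᶠ x (¬ᶠ α)) × (¬ᶠ ∃ᶠ x α ⊣⊢ ∀ᶠ x (¬ᶠ α)) )
    × ( (S : Signature) (φ ψ : Fm {S}) (x : Var) → IsInc φ → IsInc ψ → NotFreeIn x ψ →
          ((∀ᶠ x φ ∧ᶠ ψ) ⊣⊢ ∀ᶠ x (φ ∧ᶠ ψ)) )
    × ( (S : Signature) (φ ψ : Fm {S}) (x : Var) → IsInc φ → IsInc ψ → NotFreeIn x ψ →
          ((∃ᶠ x φ ∧ᶠ ψ) ⊣⊢ ∃ᶠ x (φ ∧ᶠ ψ)) )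
    × ( (S : Signature) (φ ψ : Fm {S}) (x : Var) → IsInc φ → IsInc ψ → NotFreeIn x ψ →
          ((∃ᶠ x φ ∨ᶠ ψ) ⊣⊢ ∃ᶠ x (φ ∨ᶠ ψ)) )
mainTheorem9 =
    (λ S α x fα → ¬∀⊣⊢∃¬ α x fα , ¬∃⊣⊢∀¬ α x fα)
  , (λ S φ ψ x _ _ nψ → ∀∧⊣⊢∀[∧] nψ)
  , (λ S φ ψ x _ _ nψ → ∃∧⊣⊢∃[∧] nψ)
  , (λ S φ ψ x iφ iψ nψ → ∃∨⊣⊢∃[∨] nψ iφ iψ)
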